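{- Let $(\mathcal{K},c,\gamma)$ be a simplicial flow network and let $y=[y_{d-1},y_d]$ be an optimal solution to the linear program (LP2) below. Then the set $\mathsf{supp}(y_d)$ is a directed combinatorial $\gamma$-cut.
   Context: A simplicial flow network is a triple $(\mathcal{K},c,\gamma)$ where $\mathcal{K}$ is a finite oriented $d$-dimensional simplicial complex (simplices oriented by a fixed linear order on vertices, $\mathcal{K}^k$ the set of $k$-simplices, real chains, boundary $\partial$, coboundary $\delta p=p\circ\partial$), $c\colon\mathcal{K}^d\to\mathbb{R}_{\ge0}$ is a capacity function, and $\gamma$ is a null-homologous $(d-1)$-cycle ($\gamma=\partial\Gamma$ for some $d$-chain $\Gamma$). Adjoin to $C_d(\mathcal{K})$ one extra formal basis element $\Sigma$ with $\partial\Sigma=-\gamma$ and set $c(\Sigma)=+\infty$. (LP2) has variables $y_{d-1}\colon\mathcal{K}^{d-1}\to\mathbb{R}$ (a $(d-1)$-cochain) and $y_d\colon\mathcal{K}^d\cup\{\Sigma\}\to\mathbb{R}$; it minimizes $\sum_{\sigma\in\mathcal{K}^d\cup\{\Sigma\}} y_d(\sigma)c(\sigma)$ (with $0\cdot\infty=0$) subject to $y_{d-1}\cdot\partial\sigma+y_d(\sigma)\ge0$ for each $\sigma\in\mathcal{K}^d$, $y_{d-1}\cdot\partial\Sigma+y_d(\Sigma)=1$, and $y_d\ge0$; here $y_{d-1}\cdot\partial\sigma$ denotes the cochain $y_{d-1}$ evaluated on the chain $\partial\sigma$. The support $\mathsf{supp}(y_d)$ is $\{\sigma: y_d(\sigma)\ne0\}$.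 A directed combinatorial $\gamma$-cut is a set $C\subseteq\mathcal{K}^d$ such that there is no $d$-chain $\Gamma$ with non-negative coefficients supported on $\mathcal{K}^d\setminus C$ with $\partial\Gamma=\gamma$. -}

module Defs where

open import Level using (Level; _⊔_) renaming (suc to lsuc)
open import Data.Nat as ℕ using (ℕ; zero; suc; _∸_)
open import Data.Fin as Fin using (Fin)
open import Data.List using (List; []; _∷_; length; map; foldr; filter; removeAt; allFin)
open import Data.List.Properties using (≡-dec)
open import Data.List.Membership.Propositional using (_∈_)
open import Data.List.Relation.Unary.All using (All)
open import Data.List.Relation.Unary.Any using (Any)
open import Data.List.Relation.Unary.Linked using (Linked)
open import Data.List.Relation.Unary.Unique.Propositional using (Unique)
open import Data.List.Relation.Binary.Sublist.Propositional using (_⊆_)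
open import Data.Product using (Σ; ∃; _×_; _,_)
open import Relation.Binary.Core using (Rel)
open import Relation.Binary.Structures using (IsTotalOrder)
open import Relation.Binary.PropositionalEquality using (_≡_)
open import Relation.Nullary using (¬_; yes; no)
open import Algebra.Bundles using (CommutativeRing)

record OrderedField c ℓ₁ ℓ₂ : Set (lsuc (c ⊔ ℓ₁ ⊔ ℓ₂)) where
  field
    commutativeRing : CommutativeRing c ℓ₁
  open CommutativeRing commutativeRing public
  field
    _≤_          : Rel Carrier ℓ₂
    isTotalOrder : IsTotalOrder _≈_ _≤_
    0≉1          : ¬ (0# ≈ 1#)
    inverse      : ∀ x → ¬ (x ≈ 0#) → ∃ λ y → x * y ≈ 1#
    +-mono-≤     : ∀ {x y} z → x ≤ y → (x + z) ≤ (y + z)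
    *-nonneg     : ∀ {x y} → 0# ≤ x → 0# ≤ y → 0# ≤ (x * y)

-- A simplex is a nonempty strictly increasing list of vertices (so it is
-- oriented by the linear order of Fin n); the complex is closed under
-- taking nonempty faces (= nonempty sublists).

Simplex : ℕ → Set
Simplex n = List (Fin n)

record SimplicialComplex (n : ℕ) : Set where
  field
    simplices : List (Simplex n)
    unique    : Unique simplices
    sorted    : All (Linked Fin._<_) simplices
    nonempty  : All (λ σ → 0 ℕ.< length σ) simplices
    closed    : ∀ {σ τ} → σ ∈ simplices → τ ⊆ σ → 0 ℕ.< length τ →
                τ ∈ simplices

open SimplicialComplex public

kSimplices : ∀ {n} → SimplicialComplex n → ℕ → List (Simplex n)
kSimplices K k = filter (λ σ → length σ ℕ.≟ suc k) (simplices K)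

IsDimension : ∀ {n} → SimplicialComplex n → ℕ → Set
IsDimension K d = All (λ σ → length σ ℕ.≤ suc d) (simplices K)
                × Any (λ σ → length σ ≡ suc d) (simplices K)

module _ {c ℓ₁ ℓ₂} (F : OrderedField c ℓ₁ ℓ₂) where
  open OrderedField F

  sumF : List Carrier → Carrier
  sumF = foldr _+_ 0#

  sign : ℕ → Carrier
  sign zero    = 1#
  sign (suc i) = - sign i

  -- A k-chain / k-cochain is a function on simplices (only its values on
  -- K^k matter).
  Chain : ℕ → Set c
  Chain n = Simplex n → Carrier

  incidence : ∀ {n} → Simplex n → Simplex n → Carrier
  incidence σ τ = sumF (map (λ i → sign (Fin.toℕ i) * δ (removeAt σ i))
                           (allFin (length σ)))
    where
    δ : _ → Carrier
    δ ρ with ≡-dec Fin._≟_ ρ τ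
    ... | yes _ = 1#
    ... | no  _ = 0#

  evalBoundary : ∀ {n} → Chain n → Simplex n → Carrier
  evalBoundary y σ = sumF (map (λ i → sign (Fin.toℕ i) * y (removeAt σ i))
                              (allFin (length σ)))

  boundaryChain : ∀ {n} → SimplicialComplex n → ℕ → Chain n → Chain n
  boundaryChain K d Γ τ = sumF (map (λ σ → Γ σ * incidence σ τ) (kSimplices K d))

  HasBoundary : ∀ {n} → SimplicialComplex n → ℕ → Chain n → Chain n → Set ℓ₁
  HasBoundary K d Γ γ = ∀ τ → τ ∈ kSimplices K (d ∸ 1) → boundaryChain K d Γ τ ≈ γ τ

  pair : ∀ {n} → SimplicialComplex n → ℕ → Chain n → Chain n → Carrier
  pair K k y γ = sumF (map (λ τ → y τ * γ τ) (kSimplices K k))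

  record FlowNetwork (n : ℕ) : Set (c ⊔ ℓ₁ ⊔ ℓ₂) where
    field
      complex   : SimplicialComplex n
      dim       : ℕ
      dim≥1     : 1 ℕ.≤ dim
      isDim     : IsDimension complex dim
      capacity  : Chain n
      cap≥0     : ∀ σ → σ ∈ kSimplices complex dim → 0# ≤ capacity σ
      γ         : Chain n
      nullHom   : ∃ λ (Γ : Chain n) → HasBoundary complex dim Γ γ

  module _ {n} (N : FlowNetwork n) where
    open FlowNetwork N

    Kd Kd-1 : List (Simplex n)
    Kd   = kSimplices complex dim
    Kd-1 = kSimplices complex (dim ∸ 1)

    -- A candidate solution y = [y_{d-1}, y_d] of (LP2); y_d is given by its
    -- values on K^d (yd) and on the extra element Σ (yΣ).
    record LP2Sol : Set c where
      constructor sol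
      field
        yd-1 : Chain n
        yd   : Chain n
        yΣ   : Carrier

    open LP2Sol public

    -- y_{d-1} · ∂Σ, where ∂Σ = -γ
    evalBoundaryΣ : Chain n → Carrier
    evalBoundaryΣ y = - pair complex (dim ∸ 1) y γ

    Feasible : LP2Sol → Set (ℓ₁ ⊔ ℓ₂)
    Feasible y =
        (∀ σ → σ ∈ Kd → 0# ≤ (evalBoundary (yd-1 y) σ + yd y σ))
      × (evalBoundaryΣ (yd-1 y) + yΣ y ≈ 1#)
      × (∀ σ → σ ∈ Kd → 0# ≤ yd y σ)
      × (0# ≤ yΣ y)

    -- the finite part Σ_{σ ∈ K^d} y_d(σ) c(σ) of the objective; the full
    -- objective is this value if y_d(Σ) = 0 (as 0·∞ = 0) and +∞ otherwise.
    finiteObjective : LP2Sol → Carrier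
    finiteObjective y = sumF (map (λ σ → yd y σ * capacity σ) Kd)

    -- objective(y) ≤ objective(y') in ℝ ∪ {+∞}
    ObjectiveLE : LP2Sol → LP2Sol → Set (ℓ₁ ⊔ ℓ₂)
    ObjectiveLE y y' = yΣ y' ≈ 0# → (yΣ y ≈ 0# × finiteObjective y ≤ finiteObjective y')

    Optimal : LP2Sol → Set (c ⊔ ℓ₁ ⊔ ℓ₂)
    Optimal y = Feasible y × (∀ y' → Feasible y' → ObjectiveLE y y')

    InSupport : LP2Sol → Simplex n → Set ℓ₁
    InSupport y σ = σ ∈ Kd × ¬ (yd y σ ≈ 0#)

    IsDirectedCut : (Simplex n → Set ℓ₁) → Set (c ⊔ ℓ₁ ⊔ ℓ₂)
    IsDirectedCut C =
      (∀ σ → C σ → σ ∈ Kd) ×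
      ¬ (∃ λ (Γ : Chain n) →
            (∀ σ → σ ∈ Kd → 0# ≤ Γ σ)
          × (∀ σ → σ ∈ Kd → C σ → Γ σ ≈ 0#)
          × HasBoundary complex dim Γ γ)

    γNonzero : Set ℓ₁
    γNonzero = ∃ λ τ → τ ∈ Kd-1 × ¬ (γ τ ≈ 0#)

-- Since γ ≠ 0, the cochain y_{d-1} = -γ(τ₀)⁻¹·1_{τ₀} for some τ₀ with γ(τ₀) ≠ 0, together with
-- y_d(σ) = max(0, -(y_{d-1}·∂σ)), is feasible with y_d(Σ) = 0.  So an optimal y has y_d(Σ) = 0,
-- and the Σ-constraint becomes ⟨y_{d-1}, γ⟩ = -1.  If a flow Γ ≥ 0 with ∂Γ = γ avoided
-- supp(y_d), then ⟨y_{d-1}, γ⟩ = ⟨y_{d-1}, ∂Γ⟩ = Σ_σ Γ(σ)(y_{d-1}·∂σ) ≥ 0, since on every σ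
-- either Γ(σ) = 0, or y_d(σ) = 0 and the σ-constraint gives y_{d-1}·∂σ ≥ 0.
module Submission where

open import Defs

open import Algebra.Bundles using (CommutativeSemiring)
import Algebra.Properties.CommutativeSemigroup as CommutativeSemigroupProperties
import Algebra.Properties.Ring as RingProperties
open import Data.Empty using (⊥-elim)
import Data.Fin as Fin
open import Data.List using (List; []; _∷_; length; map; foldr; removeAt; allFin)
open import Data.List.Properties using (≡-dec; length-removeAt′)
open import Data.List.Membership.Propositional using (_∈_)
open import Data.List.Membership.Propositional.Properties using (∈-filter⁺; ∈-filter⁻)
open import Data.List.Relation.Binary.Sublist.Propositional using (_⊆_; _∷_; _∷ʳ_; ⊆-refl)
open import Data.List.Relation.Unary.All as All using (All; []; _∷_)
open import Data.List.Relation.Unary.AllPairs using (_∷_)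
open import Data.List.Relation.Unary.Any using (here; there)
open import Data.List.Relation.Unary.Unique.Propositional using (Unique)
import Data.List.Relation.Unary.Unique.Propositional.Properties as Unique
open import Data.Nat as ℕ using (ℕ; suc; _∸_; s≤s; z≤n)
import Data.Nat.Properties as ℕ
open import Data.Product using (Σ; _×_; _,_; proj₁)
open import Data.Sum using (inj₁; inj₂)
open import Function using (_∘_)
open import Relation.Binary.PropositionalEquality as ≡ using (_≡_; _≢_)
import Relation.Binary.Reasoning.Setoid
open import Relation.Binary.Structures using (IsTotalOrder)
open import Relation.Nullary using (¬_; yes; no)
open import Relation.Nullary.Negation using (¬¬-Monad; ¬¬-map)

module ListSum {c ℓ} (R : CommutativeSemiring c ℓ) where
  open CommutativeSemiring R
  open CommutativeSemigroupProperties +-commutativeSemigroup using (interchange)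
  open CommutativeSemigroupProperties *-commutativeSemigroup using (x∙yz≈y∙xz)
  open Relation.Binary.Reasoning.Setoid setoid

  sum : List Carrier → Carrier
  sum = foldr _+_ 0#

  module _ {a} {A : Set a} where
    sum-cong : ∀ (xs : List A) {f g : A → Carrier} → (∀ x → x ∈ xs → f x ≈ g x) →
               sum (map f xs) ≈ sum (map g xs)
    sum-cong []       f≈g = refl
    sum-cong (x ∷ xs) f≈g = +-cong (f≈g x (here ≡.refl)) (sum-cong xs (λ z z∈ → f≈g z (there z∈)))

    sum-zero : ∀ (xs : List A) {f : A → Carrier} → (∀ x → x ∈ xs → f x ≈ 0#) →
               sum (map f xs) ≈ 0#
    sum-zero []       f≈0 = refl
    sum-zero (x ∷ xs) f≈0 =
      trans (+-cong (f≈0 x (here ≡.refl)) (sum-zero xs (λ z z∈ → f≈0 z (there z∈)))) (+-identityˡ 0#)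

    *-distribˡ-sum : ∀ k (xs : List A) (f : A → Carrier) →
                     k * sum (map f xs) ≈ sum (map (λ x → k * f x) xs)
    *-distribˡ-sum k []       f = zeroʳ k
    *-distribˡ-sum k (x ∷ xs) f = trans (distribˡ k (f x) _) (+-cong refl (*-distribˡ-sum k xs f))

    sum-+ : ∀ (xs : List A) (f g : A → Carrier) →
            sum (map (λ x → f x + g x) xs) ≈ sum (map f xs) + sum (map g xs)
    sum-+ []       f g = sym (+-identityˡ 0#)
    sum-+ (x ∷ xs) f g = trans (+-cong refl (sum-+ xs f g)) (interchange (f x) (g x) _ _)

    sum-single : ∀ {xs : List A} → Unique xs → ∀ {x} → x ∈ xs → (f : A → Carrier) →
                 (∀ z → z ∈ xs → z ≢ x → f z ≈ 0#) → sum (map f xs) ≈ f x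
    sum-single {z ∷ zs} (z∉zs ∷ _) (here ≡.refl) f f≈0 =
      trans (+-cong refl (sum-zero zs (λ w w∈ → f≈0 w (there w∈) (λ w≡z → All.lookup z∉zs w∈ (≡.sym w≡z)))))
            (+-identityʳ _)
    sum-single {z ∷ zs} (z∉zs ∷ zs!) (there x∈) f f≈0 =
      trans (+-cong (f≈0 z (here ≡.refl) (All.lookup z∉zs x∈)) (sum-single zs! x∈ f (λ w w∈ → f≈0 w (there w∈))))
            (+-identityˡ _)

  module _ {a b} {A : Set a} {B : Set b} where
    sum-swap : ∀ (xs : List A) (ys : List B) (f : A → B → Carrier) →
               sum (map (λ x → sum (map (f x) ys)) xs) ≈ sum (map (λ y → sum (map (λ x → f x y) xs)) ys)
    sum-swap []       ys f = sym (sum-zero ys (λ _ _ → refl))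
    sum-swap (x ∷ xs) ys f =
      trans (+-cong refl (sum-swap xs ys f)) (sym (sum-+ ys (f x) (λ y → sum (map (λ x → f x y) xs))))

    sum-swap-* : ∀ (xs : List A) (ys : List B) (u : A → Carrier) (v : B → Carrier) (w : A → B → Carrier) →
                 sum (map (λ x → u x * sum (map (λ y → v y * w x y) ys)) xs) ≈
                 sum (map (λ y → v y * sum (map (λ x → u x * w x y) xs)) ys)
    sum-swap-* xs ys u v w = begin
      sum (map (λ x → u x * sum (map (λ y → v y * w x y) ys)) xs)
        ≈⟨ sum-cong xs (λ x _ → *-distribˡ-sum (u x) ys (λ y → v y * w x y)) ⟩
      sum (map (λ x → sum (map (λ y → u x * (v y * w x y)) ys)) xs)
        ≈⟨ sum-swap xs ys (λ x y → u x * (v y * w x y)) ⟩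
      sum (map (λ y → sum (map (λ x → u x * (v y * w x y)) xs)) ys)
        ≈⟨ sum-cong ys (λ y _ → sum-cong xs (λ x _ → x∙yz≈y∙xz (u x) (v y) (w x y))) ⟩
      sum (map (λ y → sum (map (λ x → v y * (u x * w x y)) xs)) ys)
        ≈⟨ sum-cong ys (λ y _ → *-distribˡ-sum (v y) xs (λ x → u x * w x y)) ⟨
      sum (map (λ y → v y * sum (map (λ x → u x * w x y) xs)) ys)
        ∎

module OrderedFieldProperties {c ℓ₁ ℓ₂} (F : OrderedField c ℓ₁ ℓ₂) where
  open OrderedField F
  open IsTotalOrder isTotalOrder
    using (total; antisym; ≤-respˡ-≈; ≤-respʳ-≈)
    renaming (refl to ≤-refl; trans to ≤-trans; reflexive to ≤-reflexive)
  open RingProperties ring using (-‿involutive; -1*x≈-x)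
  open ListSum commutativeSemiring using (sum)

  +-mono-≤₂ : ∀ {a b x y} → a ≤ b → x ≤ y → (a + x) ≤ (b + y)
  +-mono-≤₂ {a} {b} {x} {y} a≤b x≤y =
    ≤-trans (+-mono-≤ x a≤b) (≤-respˡ-≈ (+-comm x b) (≤-respʳ-≈ (+-comm y b) (+-mono-≤ b x≤y)))

  x≤0⇒0≤-x : ∀ {x} → x ≤ 0# → 0# ≤ (- x)
  x≤0⇒0≤-x {x} x≤0 = ≤-respˡ-≈ (-‿inverseʳ x) (≤-respʳ-≈ (+-identityˡ (- x)) (+-mono-≤ (- x) x≤0))

  -- If 1 ≤ 0 then 0 ≤ -1, and squaring gives 0 ≤ 1 anyway.
  0≤1 : 0# ≤ 1#
  0≤1 with total 0# 1#
  ... | inj₁ 0≤1 = 0≤1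
  ... | inj₂ 1≤0 = ≤-respʳ-≈ (trans (-1*x≈-x (- 1#)) (-‿involutive 1#)) (*-nonneg 0≤-1 0≤-1)
    where
    0≤-1 : 0# ≤ (- 1#)
    0≤-1 = x≤0⇒0≤-x 1≤0

  1≰0 : ¬ (1# ≤ 0#)
  1≰0 1≤0 = 0≉1 (antisym 0≤1 1≤0)

  sum-nonneg : ∀ {a} {A : Set a} {xs : List A} {f : A → Carrier} →
               All (λ x → 0# ≤ f x) xs → 0# ≤ sum (map f xs)
  sum-nonneg []            = ≤-refl
  sum-nonneg (0≤fx ∷ 0≤fs) = ≤-respˡ-≈ (+-identityˡ 0#) (+-mono-≤₂ 0≤fx (sum-nonneg 0≤fs))

  negPart : Carrier → Carrier
  negPart x with total 0# x
  ... | inj₁ _ = 0#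
  ... | inj₂ _ = - x

  0≤negPart : ∀ x → 0# ≤ negPart x
  0≤negPart x with total 0# x
  ... | inj₁ _   = ≤-refl
  ... | inj₂ x≤0 = x≤0⇒0≤-x x≤0

  0≤x+negPart : ∀ x → 0# ≤ (x + negPart x)
  0≤x+negPart x with total 0# x
  ... | inj₁ 0≤x = ≤-respʳ-≈ (sym (+-identityʳ x)) 0≤x
  ... | inj₂ _   = ≤-reflexive (sym (-‿inverseʳ x))

removeAt-⊆ : ∀ {a} {A : Set a} (xs : List A) i → removeAt xs i ⊆ xs
removeAt-⊆ (x ∷ xs) Fin.zero    = x ∷ʳ ⊆-refl
removeAt-⊆ (x ∷ xs) (Fin.suc i) = ≡.refl ∷ removeAt-⊆ xs i

module Faces {n : ℕ} (K : SimplicialComplex n) where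
  kSimplices-unique : ∀ k → Unique (kSimplices K k)
  kSimplices-unique k = Unique.filter⁺ _ (unique K)

  face∈kSimplices : ∀ {k σ} → 1 ℕ.≤ k → σ ∈ kSimplices K k → ∀ i → removeAt σ i ∈ kSimplices K (k ∸ 1)
  face∈kSimplices {suc k} {σ} (s≤s z≤n) σ∈K i
    with σ∈K′ , |σ|≡k+2 ← ∈-filter⁻ (λ ρ → length ρ ℕ.≟ suc (suc k)) {xs = simplices K} σ∈K =
    ∈-filter⁺ (λ ρ → length ρ ℕ.≟ suc k) (closed K σ∈K′ (removeAt-⊆ σ i) 0<|face|) |face|≡k+1
    where
    |face|≡k+1 : length (removeAt σ i) ≡ suc k
    |face|≡k+1 = ℕ.suc-injective (≡.trans (≡.sym (length-removeAt′ σ i)) |σ|≡k+2)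
    0<|face| : 0 ℕ.< length (removeAt σ i)
    0<|face| = ≡.subst (0 ℕ.<_) (≡.sym |face|≡k+1) (s≤s z≤n)

module Boundary {c ℓ₁ ℓ₂} (F : OrderedField c ℓ₁ ℓ₂) {n : ℕ} where
  open OrderedField F
  open ListSum commutativeSemiring
  open Relation.Binary.Reasoning.Setoid setoid

  indicator : Simplex n → Chain F n
  indicator ρ τ with ≡-dec Fin._≟_ ρ τ
  ... | yes _ = 1#
  ... | no  _ = 0#

  indicator-≡ : ∀ ρ → indicator ρ ρ ≈ 1#
  indicator-≡ ρ with ≡-dec Fin._≟_ ρ ρ
  ... | yes _   = refl
  ... | no ρ≢ρ = ⊥-elim (ρ≢ρ ≡.refl)

  indicator-≢ : ∀ {ρ τ} → ρ ≢ τ → indicator ρ τ ≈ 0#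
  indicator-≢ {ρ} {τ} ρ≢τ with ≡-dec Fin._≟_ ρ τ
  ... | yes ρ≡τ = ⊥-elim (ρ≢τ ρ≡τ)
  ... | no  _   = refl

  sum-*-indicator : ∀ {xs} → Unique xs → ∀ {ρ} → ρ ∈ xs → (y : Chain F n) →
                    sum (map (λ τ → y τ * indicator ρ τ) xs) ≈ y ρ
  sum-*-indicator {xs} xs! {ρ} ρ∈xs y = begin
    sum (map (λ τ → y τ * indicator ρ τ) xs)
      ≈⟨ sum-single xs! ρ∈xs _ (λ τ _ τ≢ρ → trans (*-cong refl (indicator-≢ (τ≢ρ ∘ ≡.sym))) (zeroʳ (y τ))) ⟩
    y ρ * indicator ρ ρ ≈⟨ *-cong refl (indicator-≡ ρ) ⟩
    y ρ * 1#            ≈⟨ *-identityʳ (y ρ) ⟩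
    y ρ                 ∎

  -- The Kronecker delta inside `incidence` is local to Defs and cannot be named; the left-hand
  -- side of face-δ≈indicator is solved from its use in incidence-indicator.
  mutual
    incidence-indicator : ∀ σ τ → incidence F σ τ ≈ evalBoundary F (λ ρ → indicator ρ τ) σ
    incidence-indicator σ τ =
      sum-cong (allFin (length σ)) (λ i _ → *-cong refl (face-δ≈indicator σ τ i))

    face-δ≈indicator : ∀ σ τ i → _ ≈ indicator (removeAt σ i) τ
    face-δ≈indicator σ τ i with ≡-dec Fin._≟_ (removeAt σ i) τ
    ... | yes _ = refl
    ... | no  _ = refl

  module _ (K : SimplicialComplex n) {k : ℕ} (1≤k : 1 ℕ.≤ k) where
    open Faces K

    evalBoundary-incidence : ∀ (y : Chain F n) {σ} → σ ∈ kSimplices K k →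
      sum (map (λ τ → y τ * incidence F σ τ) (kSimplices K (k ∸ 1))) ≈ evalBoundary F y σ
    evalBoundary-incidence y {σ} σ∈K = begin
      sum (map (λ τ → y τ * incidence F σ τ) K[k-1])
        ≈⟨ sum-cong K[k-1] (λ τ _ → *-cong refl (incidence-indicator σ τ)) ⟩
      sum (map (λ τ → y τ * evalBoundary F (λ ρ → indicator ρ τ) σ) K[k-1])
        ≈⟨ sum-swap-* K[k-1] faces y (λ i → sign F (Fin.toℕ i)) (λ τ i → indicator (removeAt σ i) τ) ⟩
      sum (map (λ i → sign F (Fin.toℕ i) * sum (map (λ τ → y τ * indicator (removeAt σ i) τ) K[k-1])) faces)
        ≈⟨ sum-cong faces (λ i _ → *-cong refl
             (sum-*-indicator (kSimplices-unique (k ∸ 1)) (face∈kSimplices 1≤k σ∈K i) y)) ⟩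
      evalBoundary F y σ
        ∎
      where
      K[k-1] = kSimplices K (k ∸ 1)
      faces = allFin (length σ)

    pair-boundaryChain : ∀ (y Γ : Chain F n) →
      pair F K (k ∸ 1) y (boundaryChain F K k Γ) ≈ sum (map (λ σ → Γ σ * evalBoundary F y σ) (kSimplices K k))
    pair-boundaryChain y Γ = begin
      pair F K (k ∸ 1) y (boundaryChain F K k Γ)
        ≈⟨ sum-swap-* (kSimplices K (k ∸ 1)) (kSimplices K k) y Γ (λ τ σ → incidence F σ τ) ⟩
      sum (map (λ σ → Γ σ * sum (map (λ τ → y τ * incidence F σ τ) (kSimplices K (k ∸ 1)))) (kSimplices K k))
        ≈⟨ sum-cong (kSimplices K k) (λ σ σ∈K → *-cong refl (evalBoundary-incidence y σ∈K)) ⟩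
      sum (map (λ σ → Γ σ * evalBoundary F y σ) (kSimplices K k))
        ∎

module LP2Properties {c ℓ₁ ℓ₂} {F : OrderedField c ℓ₁ ℓ₂} {n : ℕ} (N : FlowNetwork F n) where
  open FlowNetwork N
  open OrderedField F
  open IsTotalOrder isTotalOrder using (≤-respˡ-≈; ≤-respʳ-≈) renaming (refl to ≤-refl; reflexive to ≤-reflexive)
  open RingProperties ring using (-‿distribˡ-*; -‿involutive)
  open CommutativeSemigroupProperties *-commutativeSemigroup using (xy∙z≈x∙zy)
  open ListSum commutativeSemiring
  open OrderedFieldProperties F
  open Boundary F
  open Faces complex using (kSimplices-unique)
  open Relation.Binary.Reasoning.Setoid setoid

  pairγ : Chain F n → Carrier
  pairγ y = pair F complex (dim ∸ 1) y γ

  finiteFeasibleSolution : γNonzero F N → Σ (LP2Sol F N) (λ y → Feasible F N y × yΣ y ≈ 0#)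
  finiteFeasibleSolution (τ₀ , τ₀∈K , γτ₀≉0) with h , γτ₀*h≈1 ← inverse (γ τ₀) γτ₀≉0 =
    sol y₁ (λ σ → negPart (evalBoundary F y₁ σ)) 0# ,
    ( (λ σ _ → 0≤x+negPart (evalBoundary F y₁ σ))
    , trans (+-identityʳ _) (trans (-‿cong pairγ-y₁≈-1) (-‿involutive 1#))
    , (λ σ _ → 0≤negPart (evalBoundary F y₁ σ))
    , ≤-refl ) ,
    refl
    where
    y₁ : Chain F n
    y₁ τ = - h * indicator τ₀ τ

    pairγ-y₁≈-1 : pairγ y₁ ≈ - 1#
    pairγ-y₁≈-1 = begin
      sum (map (λ τ → (- h * indicator τ₀ τ) * γ τ) (Kd-1 F N))
        ≈⟨ sum-cong (Kd-1 F N) (λ τ _ → xy∙z≈x∙zy (- h) (indicator τ₀ τ) (γ τ)) ⟩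
      sum (map (λ τ → - h * (γ τ * indicator τ₀ τ)) (Kd-1 F N))
        ≈⟨ *-distribˡ-sum (- h) (Kd-1 F N) (λ τ → γ τ * indicator τ₀ τ) ⟨
      - h * sum (map (λ τ → γ τ * indicator τ₀ τ) (Kd-1 F N))
        ≈⟨ *-cong refl (sum-*-indicator (kSimplices-unique (dim ∸ 1)) τ₀∈K γ) ⟩
      - h * γ τ₀
        ≈⟨ -‿distribˡ-* h (γ τ₀) ⟨
      - (h * γ τ₀)
        ≈⟨ -‿cong (trans (*-comm h (γ τ₀)) γτ₀*h≈1) ⟩
      - 1#
        ∎

  optimal⇒yΣ≈0 : γNonzero F N → ∀ {y} → Optimal F N y → yΣ y ≈ 0#
  optimal⇒yΣ≈0 γ≢0 (_ , optimal) with y′ , feasible′ , y′Σ≈0 ← finiteFeasibleSolution γ≢0 =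
    proj₁ (optimal y′ feasible′ y′Σ≈0)

  finite-feasible⇒¬0≤pairγ : ∀ {y} → Feasible F N y → yΣ y ≈ 0# → ¬ (0# ≤ pairγ (yd-1 y))
  finite-feasible⇒¬0≤pairγ {y} (_ , Σ-constraint , _) yΣ≈0 0≤p =
    1≰0 (≤-respˡ-≈ (+-identityˡ 1#) (≤-respʳ-≈ (trans p+1≈yΣ yΣ≈0) (+-mono-≤ 1# 0≤p)))
    where
    p = pairγ (yd-1 y)
    p+1≈yΣ : p + 1# ≈ yΣ y
    p+1≈yΣ = begin
      p + 1#                ≈⟨ +-cong refl Σ-constraint ⟨
      p + (- p + yΣ y)      ≈⟨ +-assoc p (- p) (yΣ y) ⟨
      (p + - p) + yΣ y      ≈⟨ +-cong (-‿inverseʳ p) refl ⟩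
      0# + yΣ y             ≈⟨ +-identityˡ (yΣ y) ⟩
      yΣ y                  ∎

  -- Whether y_d(σ) vanishes is undecidable, so each summand is only nonnegative under double
  -- negation.
  flow-avoiding-support⇒¬¬0≤pairγ : ∀ {y} → Feasible F N y → (Γ : Chain F n) →
    (∀ σ → σ ∈ Kd F N → 0# ≤ Γ σ) → (∀ σ → σ ∈ Kd F N → InSupport F N y σ → Γ σ ≈ 0#) →
    HasBoundary F complex dim Γ γ → ¬ ¬ (0# ≤ pairγ (yd-1 y))
  flow-avoiding-support⇒¬¬0≤pairγ {y} (boundary-constraint , _) Γ Γ≥0 Γ≈0 ∂Γ≈γ =
    ¬¬-map (λ summands≥0 → ≤-respʳ-≈ (sym pairγ≈sum) (sum-nonneg summands≥0))
           (All.sequenceM ℓ₂ ¬¬-Monad (All.tabulate summand≥0))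
    where
    ∂y = evalBoundary F (yd-1 y)

    pairγ≈sum : pairγ (yd-1 y) ≈ sum (map (λ σ → Γ σ * ∂y σ) (Kd F N))
    pairγ≈sum = trans (sum-cong (Kd-1 F N) (λ τ τ∈K → *-cong refl (sym (∂Γ≈γ τ τ∈K))))
                      (pair-boundaryChain complex dim≥1 (yd-1 y) Γ)

    summand≥0 : ∀ {σ} → σ ∈ Kd F N → ¬ ¬ (0# ≤ (Γ σ * ∂y σ))
    summand≥0 {σ} σ∈K summand≱0 =
      summand≱0 (≤-reflexive (sym (trans (*-cong (Γ≈0 σ σ∈K (σ∈K , ydσ≉0)) refl) (zeroˡ (∂y σ)))))
      where
      ydσ≉0 : ¬ (yd y σ ≈ 0#)
      ydσ≉0 ydσ≈0 = summand≱0 (≤-respʳ-≈ (*-cong refl (trans (+-cong refl ydσ≈0) (+-identityʳ _)))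
                                          (*-nonneg (Γ≥0 σ σ∈K) (boundary-constraint σ σ∈K)))

lemma11 : ∀ {c ℓ₁ ℓ₂} (F : OrderedField c ℓ₁ ℓ₂) {n : ℕ} (N : FlowNetwork F n) →
          γNonzero F N →
          (y : LP2Sol F N) → Optimal F N y →
          IsDirectedCut F N (InSupport F N y)
lemma11 F N γ≢0 _ optimal@(feasible , _) =
  (λ _ → proj₁) ,
  λ (Γ , Γ≥0 , Γ≈0 , ∂Γ≈γ) →
    flow-avoiding-support⇒¬¬0≤pairγ feasible Γ Γ≥0 Γ≈0 ∂Γ≈γ
      (finite-feasible⇒¬0≤pairγ feasible (optimal⇒yΣ≈0 γ≢0 optimal))
  where open LP2Properties N
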